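{- Let $d\ge 1$ and let $(V,H),(V,H')\in\mathrm{TBPav}(d)$. Then $(V,H\cup H')\in\mathrm{TBPav}(d)$.
   Context: A simplicial complex is a pair $(V,H)$ with $V$ finite nonempty, $H\subseteq 2^V$ containing all singletons and closed under subsets; its dimension is $\max\{|X|:X\in H\}-1$. $P_{\le k}(V)$ is the set of subsets of $V$ with at most $k$ elements. A complex of dimension $d$ is paving if $P_{\le d}(V)\subseteq H$. A flat is a set $F\subseteq V$ such that $X\cup\{p\}\in H$ for every $X\in H$ with $X\subseteq F$ and every $p\in V\setminus F$. For a chain $F_0\subset\cdots\subset F_k$, a transversal of its successive differences is a set $\{x_1,\dots,x_k\}$ with $x_i\in F_i\setminus F_{i-1}$. A complex is boolean representable (BRSC) if it has a boolean matrix representation; equivalently every face is a transversal of the successive differences of some chain of flats. The $k$-truncation of $(V,H)$ is $(V,H\cap P_{\le k}(V))$; a TBRSC is a complex equal to the $k$-truncation of some BRSC for some $k\ge1$. $\mathrm{TBPav}(d)$ is the class of paving TBRSCs of dimension $d$. -}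

module Defs where

open import Data.Nat using (ℕ; suc; _≤_)
open import Data.Fin using (Fin; suc; inject₁)
open import Data.Fin.Subset using (Subset; _∈_; _∉_; _⊆_; _⊂_; _∪_; ⁅_⁆; ∣_∣)
open import Data.Product using (Σ; _×_)
open import Data.Sum using (_⊎_)
open import Relation.Binary.PropositionalEquality using (_≡_)
open import Function.Bundles using (_⇔_)

-- Vertex set V = Fin n; a family of faces H ⊆ 2^V is a predicate on subsets of V.
Family : ℕ → Set₁
Family n = Subset n → Set

record IsSimplicialComplex (n : ℕ) (H : Family n) : Set where
  field
    nonempty    : 1 ≤ n
    singletons  : ∀ (p : Fin n) → H ⁅ p ⁆
    down-closed : ∀ (X Y : Subset n) → Y ⊆ X → H X → H Y

HasDimension : ∀ {n} → Family n → ℕ → Set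
HasDimension {n} H d =
  Σ (Subset n) (λ X → H X × ∣ X ∣ ≡ suc d) × (∀ X → H X → ∣ X ∣ ≤ suc d)

IsPaving : ∀ {n} → Family n → ℕ → Set
IsPaving {n} H d = ∀ (X : Subset n) → ∣ X ∣ ≤ d → H X

IsFlat : ∀ {n} → Family n → Subset n → Set
IsFlat {n} H F =
  ∀ (X : Subset n) (p : Fin n) → H X → X ⊆ F → p ∉ F → H (X ∪ ⁅ p ⁆)

IsChainOfFlats : ∀ {n k} → Family n → (Fin (suc k) → Subset n) → Set
IsChainOfFlats {n} {k} H C =
  (∀ i → IsFlat H (C i)) × (∀ (i : Fin k) → C (inject₁ i) ⊂ C (suc i))

-- X is a transversal {x_1,...,x_k} of the successive differences of the chain C,
-- with x_i ∈ F_i ∖ F_{i-1}  (here x indexed from 0: x i ∈ C (i+1) ∖ C i).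
IsTransversal : ∀ {n k} → (Fin (suc k) → Subset n) → Subset n → Set
IsTransversal {n} {k} C X =
  Σ (Fin k → Fin n) λ x →
    (∀ i → x i ∈ C (suc i) × x i ∉ C (inject₁ i))
    × (∀ (p : Fin n) → (p ∈ X) ⇔ Σ (Fin k) (λ i → p ≡ x i))

-- Boolean representable simplicial complex (characterisation via flats):
-- every face is a transversal of the successive differences of some chain of flats.
IsBRSC : ∀ n → Family n → Set
IsBRSC n H =
  IsSimplicialComplex n H
  × (∀ (X : Subset n) → H X →
       Σ ℕ λ k → Σ (Fin (suc k) → Subset n) λ C →
         IsChainOfFlats H C × IsTransversal C X)

Truncation : ∀ {n} → Family n → ℕ → Family n
Truncation H k X = H X × ∣ X ∣ ≤ k

_≐_ : ∀ {n} → Family n → Family n → Set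
_≐_ {n} H H' = ∀ (X : Subset n) → H X ⇔ H' X

IsTBRSC : ∀ n → Family n → Set₁
IsTBRSC n H =
  Σ ℕ λ k → 1 ≤ k × Σ (Family n) λ H' → IsBRSC n H' × (H ≐ Truncation H' k)

InTBPav : ℕ → ∀ n → Family n → Set₁
InTBPav d n H =
  IsSimplicialComplex n H × HasDimension H d × IsPaving H d × IsTBRSC n H

_∪ᶠ_ : ∀ {n} → Family n → Family n → Family n
(H ∪ᶠ H') X = H X ⊎ H' X

-- Let K = H ∪ H', a paving complex of dimension d, and call F ⊆ V a flat of K up to
-- d + 1 if Z ∪ {p} ∈ K whenever Z ⊆ F, p ∉ F and |Z ∪ {p}| ≤ d + 1.  A flat of a
-- BRSC whose k-truncation (k ≥ d + 1) is H is such a set, because paving makes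
-- every Z of size ≤ d a face.  These sets include V and are closed under
-- intersection, so the sets all of whose subsets are transversals of chains of
-- them form a BRSC in which they are flats; faces of H and H' are among its faces.
-- Conversely a transversal X of size ≤ d + 1 of such a chain equals (X ∩ F) ∪ {x}
-- with F the next-to-top member and x its top element, hence lies in K.  So K is
-- the (d + 1)-truncation of this BRSC.
module Submission where

open import Defs
open import Data.Nat using (ℕ; zero; suc; _≤_; z≤n; s≤s; s≤s⁻¹)
open import Data.Nat.Properties using (≤-trans)
open import Data.Fin using (Fin; zero; suc; inject₁; fromℕ; fromℕ<)
open import Data.Fin.Subset using (Subset; _∈_; _∉_; _⊆_; _⊂_; _∪_; _∩_; ⁅_⁆; ∣_∣; ⊤; ⊥)
open import Data.Fin.Subset.Properties
  using ( _∈?_; ∈⊤; ⊥⊆; ⊆-refl; ⊆-trans; ⊆-antisym; x∈⁅x⁆; x∈⁅y⁆⇒x≡y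
        ; x∈p∪q⁺; x∈p∪q⁻; x∈p∩q⁺; x∈p∩q⁻; p∩q⊆p; p∩q⊆q; p⊂q⇒∣p∣<∣q∣ )
open import Data.Vec.Functional using (init; last; tail)
open import Data.Product using (Σ; _×_; _,_; proj₁; proj₂)
open import Data.Sum using (inj₁; inj₂)
open import Data.Empty using (⊥-elim)
open import Relation.Nullary using (yes; no)
open import Relation.Binary.PropositionalEquality using (_≡_; refl; sym; trans; subst)
open import Function using (case_of_)
open import Function.Bundles using (_⇔_; mk⇔; Equivalence)

open Equivalence using (to; from)

private
  variable
    A : Set
    n k m d : ℕ
    p q : Fin n
    X Y Z F G : Subset n
    H H' K P Q : Family n

_∷ʳ_ : (Fin k → A) → A → Fin (suc k) → A
_∷ʳ_ {k = zero}  f a zero    = a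
_∷ʳ_ {k = suc k} f a zero    = f zero
_∷ʳ_ {k = suc k} f a (suc i) = (tail f ∷ʳ a) i

∷ʳ-inject₁ : ∀ (f : Fin k → A) a i → (f ∷ʳ a) (inject₁ i) ≡ f i
∷ʳ-inject₁ f a zero    = refl
∷ʳ-inject₁ f a (suc i) = ∷ʳ-inject₁ (tail f) a i

∷ʳ-last : ∀ (f : Fin k → A) a → last (f ∷ʳ a) ≡ a
∷ʳ-last {k = zero}  f a = refl
∷ʳ-last {k = suc k} f a = ∷ʳ-last (tail f) a

data InjectOrLast : Fin (suc k) → Set where
  injected : (j : Fin k) → InjectOrLast (inject₁ j)
  isLast   : InjectOrLast (fromℕ k)

injectOrLast : (i : Fin (suc k)) → InjectOrLast i
injectOrLast {zero}  zero    = isLast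
injectOrLast {suc k} zero    = injected zero
injectOrLast {suc k} (suc i) with injectOrLast i
... | injected j = injected (suc j)
... | isLast     = isLast

⊆-last : (C : Fin (suc k) → Subset n) → (∀ i → C (inject₁ i) ⊆ C (suc i)) →
         ∀ i → C i ⊆ last C
⊆-last {zero}  C C⊆ zero    = ⊆-refl
⊆-last {suc k} C C⊆ zero    = ⊆-trans (C⊆ zero) (⊆-last (tail C) (λ j → C⊆ (suc j)) zero)
⊆-last {suc k} C C⊆ (suc i) = ⊆-last (tail C) (λ j → C⊆ (suc j)) i

⊂-∪⁅⁆ : p ∉ Z → Z ⊂ Z ∪ ⁅ p ⁆
⊂-∪⁅⁆ {p = p} p∉Z = (λ z∈Z → x∈p∪q⁺ (inj₁ z∈Z)) , p , x∈p∪q⁺ (inj₂ (x∈⁅x⁆ p)) , p∉Z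

⊆-∪⁅⁆⇒⊆ : Y ⊆ X ∪ ⁅ q ⁆ → q ∉ Y → Y ⊆ X
⊆-∪⁅⁆⇒⊆ {X = X} {q = q} Y⊆ q∉Y {z} z∈Y with x∈p∪q⁻ X ⁅ q ⁆ (Y⊆ z∈Y)
... | inj₁ z∈X = z∈X
... | inj₂ z∈q = ⊥-elim (q∉Y (subst (_∈ _) (x∈⁅y⁆⇒x≡y q z∈q) z∈Y))

≡-∩-∪⁅⁆ : Y ⊆ (Y ∩ G) ∪ ⁅ q ⁆ → q ∈ Y → Y ≡ (Y ∩ G) ∪ ⁅ q ⁆
≡-∩-∪⁅⁆ {Y = Y} {G = G} {q = q} Y⊆ q∈Y = ⊆-antisym Y⊆ ⊇
  where
  ⊇ : (Y ∩ G) ∪ ⁅ q ⁆ ⊆ Y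
  ⊇ z∈ with x∈p∪q⁻ (Y ∩ G) ⁅ q ⁆ z∈
  ... | inj₁ z∈Y∩G = p∩q⊆p Y G z∈Y∩G
  ... | inj₂ z∈q   = subst (_∈ Y) (sym (x∈⁅y⁆⇒x≡y q z∈q)) q∈Y

IsChainIn : Family n → (Fin (suc k) → Subset n) → Set
IsChainIn P C = (∀ i → P (C i)) × (∀ i → C (inject₁ i) ⊂ C (suc i))

ChainTransversal : Family n → Subset n → Set
ChainTransversal {n} P X =
  Σ ℕ λ k → Σ (Fin (suc k) → Subset n) λ C → IsChainIn P C × IsTransversal C X

chainTransversal-map : (∀ F → P F → Q F) → ChainTransversal P X → ChainTransversal Q X
chainTransversal-map P⇒Q (k , C , (PC , C⊂) , tr) = k , C , ((λ i → P⇒Q (C i) (PC i)) , C⊂) , tr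

transversal-∩ : ∀ {C : Fin (suc k) → Subset n} G → (∀ {F} → P F → P (F ∩ G)) →
                IsChainIn P C → IsTransversal C X → X ⊆ G →
                IsChainIn P (λ i → C i ∩ G) × IsTransversal (λ i → C i ∩ G) X
transversal-∩ {C = C} G P∩G (PC , C⊂) (x , x∈ , X⇔) X⊆G =
  ((λ i → P∩G (PC i)) , C∩G⊂) , x , (λ i → x∈C∩G (proj₁ (x∈ i)) , ∉∩G (proj₂ (x∈ i))) , X⇔
  where
  x∈C∩G : ∀ {i F} → x i ∈ F → x i ∈ F ∩ G
  x∈C∩G {i} x∈F = x∈p∩q⁺ (x∈F , X⊆G (from (X⇔ (x i)) (i , refl)))
  ∉∩G : p ∉ F → p ∉ F ∩ G
  ∉∩G {F = F} p∉F p∈ = p∉F (p∩q⊆p F G p∈)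
  C∩G⊂ : ∀ i → C (inject₁ i) ∩ G ⊂ C (suc i) ∩ G
  C∩G⊂ i = (λ {z} z∈ → let (z∈C , z∈G) = x∈p∩q⁻ _ G z∈ in x∈p∩q⁺ (proj₁ (C⊂ i) z∈C , z∈G))
         , x i , x∈C∩G (proj₁ (x∈ i)) , ∉∩G (proj₂ (x∈ i))

transversal-∷ʳ : ∀ {C : Fin (suc k) → Subset n} → P F → last C ⊆ F → q ∈ F → q ∉ last C →
                 IsChainIn P C → IsTransversal C X →
                 IsChainIn P (C ∷ʳ F) × IsTransversal (C ∷ʳ F) (X ∪ ⁅ q ⁆)
transversal-∷ʳ {k = k} {P = P} {F = F} {q = q} {X = X} {C = C}
               PF top⊆F q∈F q∉top (PC , C⊂) (x , x∈ , X⇔) =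
  (PC′ , C′⊂) , x ∷ʳ q , x′∈ , X∪q⇔
  where
  PC′ : ∀ i → P ((C ∷ʳ F) i)
  PC′ i with injectOrLast i
  ... | injected j = subst P (sym (∷ʳ-inject₁ C F j)) (PC j)
  ... | isLast     = subst P (sym (∷ʳ-last C F)) PF
  C′⊂ : ∀ i → (C ∷ʳ F) (inject₁ i) ⊂ (C ∷ʳ F) (suc i)
  C′⊂ i with injectOrLast i
  ... | injected j rewrite ∷ʳ-inject₁ C F (inject₁ j) | ∷ʳ-inject₁ (tail C) F j = C⊂ j
  ... | isLast     rewrite ∷ʳ-inject₁ C F (fromℕ k) | ∷ʳ-last (tail C) F = top⊆F , q , q∈F , q∉top
  x′∈ : ∀ i → (x ∷ʳ q) i ∈ (C ∷ʳ F) (suc i) × (x ∷ʳ q) i ∉ (C ∷ʳ F) (inject₁ i)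
  x′∈ i with injectOrLast i
  ... | injected j rewrite ∷ʳ-inject₁ x q j | ∷ʳ-inject₁ C F (inject₁ j) | ∷ʳ-inject₁ (tail C) F j
    = x∈ j
  ... | isLast     rewrite ∷ʳ-last x q | ∷ʳ-inject₁ C F (fromℕ k) | ∷ʳ-last (tail C) F
    = q∈F , q∉top
  X∪q⇔ : ∀ p → p ∈ X ∪ ⁅ q ⁆ ⇔ Σ (Fin (suc k)) (λ i → p ≡ (x ∷ʳ q) i)
  X∪q⇔ p = mk⇔ fwd bwd
    where
    fwd : p ∈ X ∪ ⁅ q ⁆ → Σ (Fin (suc k)) (λ i → p ≡ (x ∷ʳ q) i)
    fwd p∈ with x∈p∪q⁻ X ⁅ q ⁆ p∈
    ... | inj₁ p∈X = let (j , p≡xj) = to (X⇔ p) p∈X in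
                     inject₁ j , trans p≡xj (sym (∷ʳ-inject₁ x q j))
    ... | inj₂ p∈q = fromℕ k , trans (x∈⁅y⁆⇒x≡y q p∈q) (sym (∷ʳ-last x q))
    bwd : Σ (Fin (suc k)) (λ i → p ≡ (x ∷ʳ q) i) → p ∈ X ∪ ⁅ q ⁆
    bwd (i , p≡) with injectOrLast i
    ... | injected j = x∈p∪q⁺ (inj₁ (from (X⇔ p) (j , trans p≡ (∷ʳ-inject₁ x q j))))
    ... | isLast     = x∈p∪q⁺ (inj₂ (subst (_∈ ⁅ q ⁆) (sym (trans p≡ (∷ʳ-last x q))) (x∈⁅x⁆ q)))

TransversalComplex : Family n → Family n
TransversalComplex P X = ∀ Y → Y ⊆ X → ChainTransversal P Y

chainTransversal-∪⁅⁆ : P ⊤ → (∀ {F} → P F → P (F ∩ G)) → X ⊆ G → q ∉ G →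
                       ChainTransversal P X → ChainTransversal P (X ∪ ⁅ q ⁆)
chainTransversal-∪⁅⁆ {P = P} {G = G} P⊤ P∩G X⊆G q∉G (k , C , chain , tr) =
  let (chain∩G , tr∩G) = transversal-∩ {P = P} {C = C} G P∩G chain tr X⊆G
  in suc k , (λ i → C i ∩ G) ∷ʳ ⊤ ,
     transversal-∷ʳ {P = P} P⊤ (λ _ → ∈⊤) ∈⊤ (λ q∈ → q∉G (p∩q⊆q _ G q∈)) chain∩G tr∩G

transversalComplex-isFlat : P ⊤ → (∀ {F G} → P F → P G → P (F ∩ G)) → P G →
                            IsFlat (TransversalComplex P) G
transversalComplex-isFlat {P = P} {G = G} P⊤ P∩ PG X q hX X⊆G q∉G Y Y⊆X∪q with q ∈? Y
... | no q∉Y = hX Y (⊆-∪⁅⁆⇒⊆ Y⊆X∪q q∉Y)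
... | yes q∈Y =
  subst (ChainTransversal P) (sym (≡-∩-∪⁅⁆ Y⊆ q∈Y))
    (chainTransversal-∪⁅⁆ {P = P} P⊤ (λ PF → P∩ PF PG) (p∩q⊆q Y G) q∉G (hX (Y ∩ G) Y∩G⊆X))
  where
  Y∩G⊆X : Y ∩ G ⊆ X
  Y∩G⊆X = ⊆-∪⁅⁆⇒⊆ (λ z∈ → Y⊆X∪q (p∩q⊆p Y G z∈)) (λ q∈ → q∉G (p∩q⊆q Y G q∈))
  Y⊆ : Y ⊆ (Y ∩ G) ∪ ⁅ q ⁆
  Y⊆ {z} z∈Y with x∈p∪q⁻ X ⁅ q ⁆ (Y⊆X∪q z∈Y)
  ... | inj₁ z∈X = x∈p∪q⁺ (inj₁ (x∈p∩q⁺ (z∈Y , X⊆G z∈X)))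
  ... | inj₂ z∈q = x∈p∪q⁺ (inj₂ z∈q)

transversalComplex-isBRSC : 1 ≤ n → (∀ p → TransversalComplex P ⁅ p ⁆) →
                            P ⊤ → (∀ {F G} → P F → P G → P (F ∩ G)) →
                            IsBRSC n (TransversalComplex P)
transversalComplex-isBRSC {P = P} 1≤n singletons P⊤ P∩ =
  record
    { nonempty    = 1≤n
    ; singletons  = singletons
    ; down-closed = λ X Y Y⊆X hX Z Z⊆Y → hX Z (λ z∈Z → Y⊆X (Z⊆Y z∈Z))
    }
  , λ X hX → chainTransversal-map (λ F → transversalComplex-isFlat {P = P} {G = F} P⊤ P∩)
                                   (hX X ⊆-refl)

IsFlatUpTo : Family n → ℕ → Subset n → Set
IsFlatUpTo {n} K m F =
  ∀ (Z : Subset n) (p : Fin n) → Z ⊆ F → p ∉ F → ∣ Z ∪ ⁅ p ⁆ ∣ ≤ m → K (Z ∪ ⁅ p ⁆)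

isFlatUpTo-⊤ : IsFlatUpTo K m ⊤
isFlatUpTo-⊤ Z p _ p∉⊤ _ = ⊥-elim (p∉⊤ ∈⊤)

isFlatUpTo-∩ : IsFlatUpTo K m F → IsFlatUpTo K m G → IsFlatUpTo K m (F ∩ G)
isFlatUpTo-∩ {F = F} {G = G} flatF flatG Z p Z⊆F∩G p∉F∩G size with p ∈? F
... | no p∉F  = flatF Z p (λ z∈ → p∩q⊆p F G (Z⊆F∩G z∈)) p∉F size
... | yes p∈F =
  flatG Z p (λ z∈ → p∩q⊆q F G (Z⊆F∩G z∈)) (λ p∈G → p∉F∩G (x∈p∩q⁺ (p∈F , p∈G))) size

chainTransversal⇒face : K ⊥ → ChainTransversal (IsFlatUpTo K m) X → ∣ X ∣ ≤ m → K X
chainTransversal⇒face {K = K} K⊥ (zero , C , _ , x , _ , X⇔) _ =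
  subst K (⊆-antisym ⊥⊆ λ {z} z∈X → case to (X⇔ z) z∈X of λ ()) K⊥
chainTransversal⇒face {K = K} {m = m} {X = X} K⊥ (suc k , C , (flat , C⊂) , x , x∈ , X⇔) ∣X∣≤m =
  subst K (sym X≡) (flat _ (X ∩ penultimate) (last x) (p∩q⊆q X penultimate)
                         (proj₂ (x∈ (fromℕ k))) (subst (λ Y → ∣ Y ∣ ≤ m) X≡ ∣X∣≤m))
  where
  penultimate : Subset _
  penultimate = last (init C)
  X⊆ : X ⊆ (X ∩ penultimate) ∪ ⁅ last x ⁆
  X⊆ {z} z∈X with to (X⇔ z) z∈X
  ... | i , z≡xi with injectOrLast i
  ...   | injected j = x∈p∪q⁺ (inj₁ (x∈p∩q⁺ (z∈X , subst (_∈ penultimate) (sym z≡xi) x∈penultimate)))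
    where
    x∈penultimate : x (inject₁ j) ∈ penultimate
    x∈penultimate = ⊆-last (init C) (λ l → proj₁ (C⊂ (inject₁ l))) (suc j) (proj₁ (x∈ (inject₁ j)))
  ...   | isLast     = x∈p∪q⁺ (inj₂ (subst (_∈ ⁅ last x ⁆) (sym z≡xi) (x∈⁅x⁆ (last x))))
  X≡ : X ≡ (X ∩ penultimate) ∪ ⁅ last x ⁆
  X≡ = ≡-∩-∪⁅⁆ X⊆ (from (X⇔ (last x)) (fromℕ k , refl))

isFlat⇒isFlatUpTo : ∀ {H₁ : Family n} → IsPaving H d → H ≐ Truncation H₁ k → suc d ≤ k →
                    (∀ {X} → H X → K X) → IsFlat H₁ F → IsFlatUpTo K (suc d) F
isFlat⇒isFlatUpTo {d = d} {H₁ = H₁} pav H≐ d<k H⊆K flat Z p Z⊆F p∉F size =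
  H⊆K (from (H≐ _) (flat Z p H₁Z Z⊆F p∉F , ≤-trans size d<k))
  where
  ∣Z∣≤d : ∣ Z ∣ ≤ d
  ∣Z∣≤d = s≤s⁻¹ (≤-trans (p⊂q⇒∣p∣<∣q∣ (⊂-∪⁅⁆ (λ p∈Z → p∉F (Z⊆F p∈Z)))) size)
  H₁Z : H₁ Z
  H₁Z = proj₁ (to (H≐ Z) (pav Z ∣Z∣≤d))

inTBPav⇒chainTransversal : InTBPav d n H → (∀ {X} → H X → K X) →
                           H X → ChainTransversal (IsFlatUpTo K (suc d)) X
inTBPav⇒chainTransversal {d = d}
  (_ , ((X₀ , HX₀ , ∣X₀∣≡) , _) , pav , k , _ , _ , (_ , faces) , H≐) H⊆K HX =
  chainTransversal-map (λ F → isFlat⇒isFlatUpTo {F = F} pav H≐ d<k H⊆K)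
                       (faces _ (proj₁ (to (H≐ _) HX)))
  where
  d<k : suc d ≤ k
  d<k = subst (_≤ k) ∣X₀∣≡ (proj₂ (to (H≐ X₀) HX₀))

isTBRSC-byFlatsUpTo : IsSimplicialComplex n K → 1 ≤ m → (∀ X → K X → ∣ X ∣ ≤ m) →
                      (∀ {X} → K X → ChainTransversal (IsFlatUpTo K m) X) → IsTBRSC n K
isTBRSC-byFlatsUpTo {n} {K} {m} sc 1≤m bounded transversal =
  m , 1≤m , TransversalComplex (IsFlatUpTo K m) ,
  transversalComplex-isBRSC {P = IsFlatUpTo K m} nonempty (λ p → hereditary (singletons p))
    (isFlatUpTo-⊤ {K = K} {m = m}) (isFlatUpTo-∩ {K = K} {m = m}) ,
  λ X → mk⇔ (λ KX → hereditary KX , bounded X KX)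
            (λ (hX , ∣X∣≤m) → chainTransversal⇒face K⊥ (hX X ⊆-refl) ∣X∣≤m)
  where
  open IsSimplicialComplex sc
  hereditary : K X → TransversalComplex (IsFlatUpTo K m) X
  hereditary KX Y Y⊆X = transversal (down-closed _ Y Y⊆X KX)
  K⊥ : K ⊥
  K⊥ = down-closed _ ⊥ ⊥⊆ (singletons (fromℕ< nonempty))

∪ᶠ-isSimplicialComplex : IsSimplicialComplex n H → IsSimplicialComplex n H' →
                         IsSimplicialComplex n (H ∪ᶠ H')
∪ᶠ-isSimplicialComplex sc sc' = record
  { nonempty    = nonempty sc
  ; singletons  = λ p → inj₁ (singletons sc p)
  ; down-closed = λ where X Y Y⊆X (inj₁ HX)  → inj₁ (down-closed sc X Y Y⊆X HX)
                          X Y Y⊆X (inj₂ H'X) → inj₂ (down-closed sc' X Y Y⊆X H'X)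
  }
  where open IsSimplicialComplex

∪ᶠ-hasDimension : HasDimension H d → HasDimension H' d → HasDimension (H ∪ᶠ H') d
∪ᶠ-hasDimension ((X , HX , ∣X∣≡) , bounded) (_ , bounded') =
  (X , inj₁ HX , ∣X∣≡) , λ where Y (inj₁ HY)  → bounded Y HY
                                 Y (inj₂ H'Y) → bounded' Y H'Y

theorem6p8 : ∀ (d n : ℕ) (H H' : Family n) → 1 ≤ d →
    InTBPav d n H → InTBPav d n H' → InTBPav d n (H ∪ᶠ H')
theorem6p8 d n H H' _ tH@(scH , dimH , pavH , _) tH'@(scH' , dimH' , _ , _) =
  scK , dimK , (λ X ∣X∣≤d → inj₁ (pavH X ∣X∣≤d)) ,
  isTBRSC-byFlatsUpTo scK (s≤s z≤n) (proj₂ dimK) transversal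
  where
  scK : IsSimplicialComplex n (H ∪ᶠ H')
  scK = ∪ᶠ-isSimplicialComplex scH scH'
  dimK : HasDimension (H ∪ᶠ H') d
  dimK = ∪ᶠ-hasDimension dimH dimH'
  transversal : ∀ {X} → (H ∪ᶠ H') X → ChainTransversal (IsFlatUpTo (H ∪ᶠ H') (suc d)) X
  transversal (inj₁ HX)  = inTBPav⇒chainTransversal {K = H ∪ᶠ H'} tH inj₁ HX
  transversal (inj₂ H'X) = inTBPav⇒chainTransversal {K = H ∪ᶠ H'} tH' inj₂ H'X
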